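{- Let $f(X)=X^3+c_2X^2+c_1X+c_0\in\mathbb{Z}[X]$ be irreducible, with root $r$. Regard $N(\alpha)$, $B_{13}$, $B_{22}$ (defined below) as polynomials in $a_0$ with coefficients in $\mathbb{Z}[a_1,a_2]$. Define $$R=\mathrm{Resultant}(B_{13},N(\alpha);a_0),\qquad R_0=\mathrm{Resultant}(B_{13},B_{22};a_0).$$ Let $q_0=q_0(a_1,a_2)$ be the polynomial satisfying $B_{23}B_{11}-B_{13}B_{21}=q_0N(\alpha)$; explicitly $q_0=a_2c_2-a_1$. Then $$-q_0^2R=R_0^2.$$
   Context: For $\alpha=a_0+a_1r+a_2r^2$ with indeterminates $a_0,a_1,a_2$, let $$M_\alpha=\begin{pmatrix} a_0 & -c_0a_2 & a_2c_0c_2 - a_1c_0\\ a_1 & a_0-c_1a_2 & a_2c_1c_2 - a_2c_0 - a_1c_1\\ a_2 & a_1-c_2a_2 & a_2c_2^2 - a_2c_1 - a_1c_2 + a_0 \end{pmatrix}$$ be the matrix of multiplication by $\alpha$ in the basis $\{1,r,r^2\}$, and let $N(\alpha)=\det M_\alpha$. $B_{ij}$ is $(-1)^{i+j}$ times the determinant of the matrix obtained from $M_\alpha$ by deleting row $i$ and column $j$. In particular $$B_{13}=-a_2a_0+a_2^2c_1-a_1a_2c_2+a_1^2.$$ $\mathrm{Resultant}(P_1,P_2;x)$ is the Sylvester resultant with respect to $x$. For $P_1$ with leading coefficient $\ell$ and roots $\xi_i$ it equals $\ell^{\deg P_2}\prod_i P_2(\xi_i)$. -}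

module Defs where

open import Level using (_⊔_)
open import Algebra.Bundles using (CommutativeRing)
open import Data.Bool using (if_then_else_; _∧_)
open import Data.Nat as ℕ using (ℕ; zero; suc; _∸_; _≤ᵇ_)
open import Data.Fin using (Fin; zero; suc; toℕ; punchIn)
open import Data.List using (List; []; _∷_; map)
open import Data.Integer as ℤ using (ℤ; +_; -[1+_])
open import Data.Integer.Properties using (+-*-commutativeRing)
open import Data.Product using (Σ; _×_)
open import Data.Sum using (_⊎_)
open import Relation.Nullary using (¬_)

-- Polynomials in one indeterminate over a commutative ring R, as lists
-- of coefficients (constant term first).  No normalisation is done;
-- equality of polynomials is coefficientwise (trailing zeros ignored).

module Poly {c ℓ} (R : CommutativeRing c ℓ) where
  open CommutativeRing R

  Pol : Set c
  Pol = List Carrier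

  coeff : Pol → ℕ → Carrier
  coeff []      _       = 0#
  coeff (x ∷ p) zero    = x
  coeff (x ∷ p) (suc k) = coeff p k

  _≈P_ : Pol → Pol → Set ℓ
  p ≈P q = ∀ k → coeff p k ≈ coeff q k

  const : Carrier → Pol
  const a = a ∷ []

  X : Pol
  X = 0# ∷ 1# ∷ []

  _⊕_ : Pol → Pol → Pol
  []      ⊕ q       = q
  (x ∷ p) ⊕ []      = x ∷ p
  (x ∷ p) ⊕ (y ∷ q) = (x + y) ∷ (p ⊕ q)

  ⊖_ : Pol → Pol
  ⊖ p = map -_ p

  _⊗_ : Pol → Pol → Pol
  []      ⊗ q = []
  (x ∷ p) ⊗ q = map (x *_) q ⊕ (0# ∷ (p ⊗ q))

  IsUnit : Pol → Set (c ⊔ ℓ)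
  IsUnit p = Σ Pol (λ q → (p ⊗ q) ≈P const 1#)

  Irreducible : Pol → Set (c ⊔ ℓ)
  Irreducible p = (¬ IsUnit p) × (∀ g h → p ≈P (g ⊗ h) → IsUnit g ⊎ IsUnit h)

module Det {a} {A : Set a} (_+A_ _*A_ : A → A → A) (negA : A → A) (0A 1A : A) where

  sumF : ∀ {n} → (Fin n → A) → A
  sumF {zero}  f = 0A
  sumF {suc n} f = f zero +A sumF (λ i → f (suc i))

  sgn : ℕ → A → A
  sgn zero          x = x
  sgn (suc zero)    x = negA x
  sgn (suc (suc k)) x = sgn k x

  det : ∀ n → (Fin n → Fin n → A) → A
  det zero    M = 1A
  det (suc n) M =
    sumF (λ j → sgn (toℕ j) (M zero j *A det n (λ i k → M (suc i) (punchIn j k))))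

  cofactor : ∀ n → (Fin (suc n) → Fin (suc n) → A) → Fin (suc n) → Fin (suc n) → A
  cofactor n M i j = sgn (toℕ i ℕ.+ toℕ j) (det n (λ k l → M (punchIn i k) (punchIn j l)))

-- Sylvester resultant of P (formal degree m) and Q (formal degree n).

module Res {c ℓ} (R : CommutativeRing c ℓ) where
  open CommutativeRing R using (Carrier; _+_; _*_; -_; 0#; 1#)
  open Poly R
  open Det _+_ _*_ -_ 0# 1#

  -- rows 0..n-1: shifted coefficients of P (leading first);
  -- rows n..n+m-1: shifted coefficients of Q (leading first).
  sylvester : (m n : ℕ) → Pol → Pol → Fin (n ℕ.+ m) → Fin (n ℕ.+ m) → Carrier
  sylvester m n P Q i j =
    let r = toℕ i ; d = toℕ j ; k = r ∸ n in
    if suc r ≤ᵇ n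
      then (if (r ≤ᵇ d) ∧ (d ≤ᵇ r ℕ.+ m) then coeff P (m ∸ (d ∸ r)) else 0#)
      else (if (k ≤ᵇ d) ∧ (d ≤ᵇ k ℕ.+ n) then coeff Q (n ∸ (d ∸ k)) else 0#)

  resultant : (m n : ℕ) → Pol → Pol → Carrier
  resultant m n P Q = det (n ℕ.+ m) (sylvester m n P Q)

module _ {c ℓ} (R : CommutativeRing c ℓ) where
  open CommutativeRing R

  fromℕ : ℕ → Carrier
  fromℕ zero    = 0#
  fromℕ (suc n) = 1# + fromℕ n

  fromℤ : ℤ → Carrier
  fromℤ (+ n)     = fromℕ n
  fromℤ -[1+ n ]  = - fromℕ (suc n)

ℤ[X]-Irreducible : List ℤ → Set
ℤ[X]-Irreducible = Poly.Irreducible +-*-commutativeRing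

cubic : ℤ → ℤ → ℤ → List ℤ
cubic c0 c1 c2 = c0 ∷ c1 ∷ c2 ∷ + 1 ∷ []

module Setting {c ℓ} (R : CommutativeRing c ℓ) (c0' c1' c2' : ℤ) (a1 a2 : CommutativeRing.Carrier R) where
  open CommutativeRing R using (Carrier; _+_; _*_; -_; _-_; 0#; 1#)
  open Poly R
  open Res R

  c0 c1 c2 : Carrier
  c0 = fromℤ R c0'
  c1 = fromℤ R c1'
  c2 = fromℤ R c2'

  -- a0 is the indeterminate X; a1, a2 are constants (coefficients)
  a0 : Pol
  a0 = X

  Mα : Fin 3 → Fin 3 → Pol
  Mα zero             zero             = a0
  Mα zero             (suc zero)       = const (- (c0 * a2))
  Mα zero             (suc (suc zero)) = const (a2 * c0 * c2 - a1 * c0)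
  Mα (suc zero)       zero             = const a1
  Mα (suc zero)       (suc zero)       = a0 ⊕ const (- (c1 * a2))
  Mα (suc zero)       (suc (suc zero)) = const (a2 * c1 * c2 - a2 * c0 - a1 * c1)
  Mα (suc (suc zero)) zero             = const a2
  Mα (suc (suc zero)) (suc zero)       = const (a1 - c2 * a2)
  Mα (suc (suc zero)) (suc (suc zero)) = a0 ⊕ const (a2 * c2 * c2 - a2 * c1 - a1 * c2)

  open Det _⊕_ _⊗_ ⊖_ [] (const 1#)

  -- N(α) and the cofactors B_ij (1-based in the paper, 0-based Fin here)
  N : Pol
  N = det 3 Mα

  B : Fin 3 → Fin 3 → Pol
  B = cofactor 2 Mα

  B13 B22 : Pol
  B13 = B zero (suc (suc zero))
  B22 = B (suc zero) (suc zero)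

  -- as polynomials in a0: deg B13 = 1, deg N = 3, deg B22 = 2
  Rr : Carrier
  Rr = resultant 1 3 B13 N

  R0 : Carrier
  R0 = resultant 1 2 B13 B22

  q0 : Carrier
  q0 = a2 * c2 - a1

-- The identity is a polynomial identity in a1, a2, c0, c1, c2 with integer
-- coefficients, so it suffices to verify it once in the ring of ring-solver
-- expressions in five variables (equality: equal evaluation in R), where both
-- sides can be brought to Horner normal form and compared by computation.

module Submission where

open import Defs
open import Level using (0ℓ; _⊔_)
open import Algebra.Bundles using (CommutativeRing; RawRing)
open import Algebra.Morphism.Structures using (IsRingMonomorphism)
import Algebra.Construct.Pointwise as Pointwise
import Algebra.Morphism.RingMonomorphism as RingMonomorphism
open import Data.Bool using (Bool; true; false; T)
open import Data.Fin using (Fin; zero; suc; #_)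
open import Data.List using ([])
open import Data.Maybe using (nothing)
open import Data.Nat as ℕ using (ℕ; zero; suc)
open import Data.Integer as ℤ using (ℤ; +_; -[1+_]; _⊖_)
import Data.Integer.Properties as ℤ
import Data.Nat.Properties as ℕ
open import Data.Vec using (Vec; []; _∷_)
open import Function using (id)
open import Relation.Binary.PropositionalEquality as ≡ using (_≡_)
open import Tactic.RingSolver.Core.AlmostCommutativeRing using (fromCommutativeRing)
open import Tactic.RingSolver.Core.Expression using (Expr; module Eval)
open import Tactic.RingSolver.Core.Polynomial.Parameters using (Homomorphism)

module IntegerEmbedding {c ℓ} (R : CommutativeRing c ℓ) where
  open CommutativeRing R
  open import Algebra.Properties.Ring ring using (-0#≈0#; -‿involutive; -‿+-comm; xyx⁻¹≈y; -‿distribˡ-*; -‿distribʳ-*)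
  open import Algebra.Properties.Semiring.Mult.TCOptimised semiring using (_×_; ×-homo-+; ×1-homo-*)
  open import Relation.Binary.Reasoning.Setoid setoid

  -- Unlike Defs.fromℤ, this sends + 1 to 1# on the nose, so evaluating the
  -- constant 1 of an expression gives back 1# definitionally.
  fromℤ′ : ℤ → Carrier
  fromℤ′ (+ n)    = n × 1#
  fromℤ′ -[1+ n ] = - (suc n × 1#)

  fromℤ′-neg : ∀ i → fromℤ′ (ℤ.- i) ≈ - fromℤ′ i
  fromℤ′-neg (+ zero)  = sym -0#≈0#
  fromℤ′-neg (+ suc n) = refl
  fromℤ′-neg -[1+ n ]  = sym (-‿involutive _)

  fromℤ′-⊖ : ∀ m n → fromℤ′ (m ⊖ n) ≈ m × 1# - n × 1#
  fromℤ′-⊖ m       zero    = sym (trans (+-congˡ -0#≈0#) (+-identityʳ _))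
  fromℤ′-⊖ zero    (suc n) = sym (+-identityˡ _)
  fromℤ′-⊖ (suc m) (suc n) = begin
    fromℤ′ (suc m ⊖ suc n)         ≡⟨ ≡.cong fromℤ′ (ℤ.[1+m]⊖[1+n]≡m⊖n m n) ⟩
    fromℤ′ (m ⊖ n)                 ≈⟨ fromℤ′-⊖ m n ⟩
    m × 1# - n × 1#                ≈⟨ shift-cancel 1# (m × 1#) (n × 1#) ⟨
    (1# + m × 1#) - (1# + n × 1#)  ≈⟨ +-cong (×-homo-+ 1# 1 m) (-‿cong (×-homo-+ 1# 1 n)) ⟨
    suc m × 1# - suc n × 1#        ∎
    where
    shift-cancel : ∀ z x y → (z + x) - (z + y) ≈ x - y
    shift-cancel z x y = begin
      (z + x) - (z + y)      ≈⟨ +-congˡ (-‿+-comm z y) ⟨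
      (z + x) + (- z + - y)  ≈⟨ +-assoc _ _ _ ⟨
      (z + x) + - z + - y    ≈⟨ +-congʳ (xyx⁻¹≈y z x) ⟩
      x - y                  ∎

  fromℤ′-+ : ∀ i j → fromℤ′ (i ℤ.+ j) ≈ fromℤ′ i + fromℤ′ j
  fromℤ′-+ (+ m)    (+ n)    = ×-homo-+ 1# m n
  fromℤ′-+ (+ m)    -[1+ n ] = fromℤ′-⊖ m (suc n)
  fromℤ′-+ -[1+ m ] (+ n)    = trans (fromℤ′-⊖ n (suc m)) (+-comm _ _)
  fromℤ′-+ -[1+ m ] -[1+ n ] = begin
    - (suc (suc (m ℕ.+ n)) × 1#)       ≡⟨ ≡.cong (λ k → - (suc k × 1#)) (ℕ.+-suc m n) ⟨
    - ((suc m ℕ.+ suc n) × 1#)         ≈⟨ -‿cong (×-homo-+ 1# (suc m) (suc n)) ⟩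
    - (suc m × 1# + suc n × 1#)        ≈⟨ -‿+-comm _ _ ⟨
    - (suc m × 1#) + - (suc n × 1#)    ∎

  fromℤ′-*-pos : ∀ m j → fromℤ′ (+ m ℤ.* j) ≈ m × 1# * fromℤ′ j
  fromℤ′-*-pos m (+ n)    = trans (reflexive (≡.cong fromℤ′ (≡.sym (ℤ.pos-* m n)))) (×1-homo-* m n)
  fromℤ′-*-pos m -[1+ n ] = begin
    fromℤ′ (+ m ℤ.* -[1+ n ])       ≡⟨ ≡.cong fromℤ′ (ℤ.neg-distribʳ-* (+ m) (+ suc n)) ⟨
    fromℤ′ (ℤ.- (+ m ℤ.* + suc n))  ≈⟨ fromℤ′-neg (+ m ℤ.* + suc n) ⟩
    - fromℤ′ (+ m ℤ.* + suc n)      ≈⟨ -‿cong (fromℤ′-*-pos m (+ suc n)) ⟩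
    - (m × 1# * suc n × 1#)         ≈⟨ -‿distribʳ-* _ _ ⟩
    m × 1# * - (suc n × 1#)         ∎

  fromℤ′-* : ∀ i j → fromℤ′ (i ℤ.* j) ≈ fromℤ′ i * fromℤ′ j
  fromℤ′-* (+ m)    j = fromℤ′-*-pos m j
  fromℤ′-* -[1+ m ] j = begin
    fromℤ′ (-[1+ m ] ℤ.* j)        ≡⟨ ≡.cong fromℤ′ (ℤ.neg-distribˡ-* (+ suc m) j) ⟨
    fromℤ′ (ℤ.- (+ suc m ℤ.* j))   ≈⟨ fromℤ′-neg (+ suc m ℤ.* j) ⟩
    - fromℤ′ (+ suc m ℤ.* j)       ≈⟨ -‿cong (fromℤ′-*-pos (suc m) j) ⟩
    - (suc m × 1# * fromℤ′ j)      ≈⟨ -‿distribˡ-* _ _ ⟩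
    - (suc m × 1#) * fromℤ′ j      ∎

  ℤ-coefficients : Homomorphism 0ℓ 0ℓ c ℓ
  ℤ-coefficients = record
    { from          = record { rawRing = CommutativeRing.rawRing ℤ.+-*-commutativeRing ; isZero = isZero }
    ; to            = fromCommutativeRing R (λ _ → nothing)
    ; morphism      = record
      { ⟦_⟧ = fromℤ′ ; +-homo = fromℤ′-+ ; *-homo = fromℤ′-* ; -‿homo = fromℤ′-neg ; 0-homo = refl ; 1-homo = refl }
    ; Zero-C⟶Zero-R = zero-homo
    }
    where
    isZero : ℤ → Bool
    isZero (+ zero) = true
    isZero _        = false

    zero-homo : ∀ i → T (isZero i) → 0# ≈ fromℤ′ i
    zero-homo (+ zero) _ = refl

module Normalisation {c ℓ} (R : CommutativeRing c ℓ) where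
  open CommutativeRing R
  open IntegerEmbedding R using (fromℤ′; ℤ-coefficients)
  open Expr
  open Eval rawRing fromℤ′ public
  open import Tactic.RingSolver.Core.Polynomial.Base (Homomorphism.from ℤ-coefficients)
  open import Tactic.RingSolver.Core.Polynomial.Semantics ℤ-coefficients renaming (⟦_⟧ to ⟦_⟧ₚ)
  open import Tactic.RingSolver.Core.Polynomial.Homomorphism ℤ-coefficients
  open import Algebra.Properties.Semiring.Exp.TCOptimised semiring using (^-congˡ)
  open import Relation.Binary.Reasoning.Setoid setoid

  -- As in Tactic.RingSolver.NonReflective, but with integer coefficients,
  -- whose zero test computes.
  norm : ∀ {n} → Expr ℤ n → Poly n
  norm (Κ x)   = κ x
  norm (Ι x)   = ι x
  norm (x ⊕ y) = norm x ⊞ norm y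
  norm (x ⊗ y) = norm x ⊠ norm y
  norm (⊝ x)   = ⊟ norm x
  norm (x ⊛ i) = norm x ⊡ i

  norm-correct : ∀ {n} (e : Expr ℤ n) ρ → ⟦ norm e ⟧ₚ ρ ≈ ⟦ e ⟧ ρ
  norm-correct (Κ x)   ρ = κ-hom x ρ
  norm-correct (Ι x)   ρ = ι-hom x ρ
  norm-correct (x ⊕ y) ρ = trans (⊞-hom (norm x) (norm y) ρ) (+-cong (norm-correct x ρ) (norm-correct y ρ))
  norm-correct (x ⊗ y) ρ = trans (⊠-hom (norm x) (norm y) ρ) (*-cong (norm-correct x ρ) (norm-correct y ρ))
  norm-correct (⊝ x)   ρ = trans (⊟-hom (norm x) ρ) (-‿cong (norm-correct x ρ))
  norm-correct (x ⊛ i) ρ = trans (⊡-hom (norm x) i ρ) (^-congˡ i (norm-correct x ρ))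

  ⟦⟧-≈-by-norm : ∀ {n} (e f : Expr ℤ n) → norm e ≡ norm f → ∀ ρ → ⟦ e ⟧ ρ ≈ ⟦ f ⟧ ρ
  ⟦⟧-≈-by-norm e f e≡f ρ = begin
    ⟦ e ⟧ ρ          ≈⟨ norm-correct e ρ ⟨
    ⟦ norm e ⟧ₚ ρ    ≡⟨ ≡.cong (λ p → ⟦ p ⟧ₚ ρ) e≡f ⟩
    ⟦ norm f ⟧ₚ ρ    ≈⟨ norm-correct f ρ ⟩
    ⟦ f ⟧ ρ          ∎

module ExpressionRing {c ℓ} (R : CommutativeRing c ℓ) (n : ℕ) where
  open CommutativeRing R
  open Normalisation R using (⟦_⟧)
  open Expr

  functionRing : CommutativeRing c (c ⊔ ℓ)
  functionRing = Pointwise.commutativeRing (Vec Carrier n) R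

  rawExprRing : RawRing 0ℓ (c ⊔ ℓ)
  rawExprRing = record
    { Carrier = Expr ℤ n
    ; _≈_     = λ e f → ∀ ρ → ⟦ e ⟧ ρ ≈ ⟦ f ⟧ ρ
    ; _+_     = _⊕_
    ; _*_     = _⊗_
    ; -_      = ⊝_
    ; 0#      = Κ (+ 0)
    ; 1#      = Κ (+ 1)
    }

  ⟦⟧-isRingMonomorphism : IsRingMonomorphism rawExprRing (CommutativeRing.rawRing functionRing) ⟦_⟧
  ⟦⟧-isRingMonomorphism = record
    { isRingHomomorphism = record
      { isSemiringHomomorphism = record
        { isNearSemiringHomomorphism = record
          { +-isMonoidHomomorphism = record
            { isMagmaHomomorphism = record
              { isRelHomomorphism = record { cong = id }
              ; homo = λ _ _ _ → refl
              }
            ; ε-homo = λ _ → refl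
            }
          ; *-homo = λ _ _ _ → refl
          }
        ; 1#-homo = λ _ → refl
        }
      ; -‿homo = λ _ _ → refl
      }
    ; injective = id
    }

  exprRing : CommutativeRing 0ℓ (c ⊔ ℓ)
  exprRing = record
    { isCommutativeRing = RingMonomorphism.isCommutativeRing ⟦⟧-isRingMonomorphism
        (CommutativeRing.isCommutativeRing functionRing)
    }

-- Defs.Setting R c0 c1 c2 a1 a2 is, definitionally, this module at the
-- elements fromℤ R cᵢ; here the cᵢ may be variables.
module GeneralSetting {c ℓ} (R : CommutativeRing c ℓ) (c0 c1 c2 a1 a2 : CommutativeRing.Carrier R) where
  open CommutativeRing R using (Carrier; _*_; -_; _-_; 1#)
  open Poly R
  open Res R

  Mα : Fin 3 → Fin 3 → Pol
  Mα zero             zero             = X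
  Mα zero             (suc zero)       = const (- (c0 * a2))
  Mα zero             (suc (suc zero)) = const (a2 * c0 * c2 - a1 * c0)
  Mα (suc zero)       zero             = const a1
  Mα (suc zero)       (suc zero)       = X ⊕ const (- (c1 * a2))
  Mα (suc zero)       (suc (suc zero)) = const (a2 * c1 * c2 - a2 * c0 - a1 * c1)
  Mα (suc (suc zero)) zero             = const a2
  Mα (suc (suc zero)) (suc zero)       = const (a1 - c2 * a2)
  Mα (suc (suc zero)) (suc (suc zero)) = X ⊕ const (a2 * c2 * c2 - a2 * c1 - a1 * c2)

  open Det _⊕_ _⊗_ ⊖_ [] (const 1#)

  B13 B22 : Pol
  B13 = cofactor 2 Mα zero (suc (suc zero))
  B22 = cofactor 2 Mα (suc zero) (suc zero)

  Rr R0 q0 : Carrier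
  Rr = resultant 1 3 B13 (det 3 Mα)
  R0 = resultant 1 2 B13 B22
  q0 = a2 * c2 - a1

resultant-identity : ∀ {c ℓ} (R : CommutativeRing c ℓ) (c0 c1 c2 a1 a2 : CommutativeRing.Carrier R) →
  let open CommutativeRing R
      open GeneralSetting R c0 c1 c2 a1 a2
  in - (q0 * q0 * Rr) ≈ R0 * R0
resultant-identity R c0 c1 c2 a1 a2 =
  -- The evaluation of an expression computed in exprRing is definitionally the
  -- same computation carried out in R.
  ⟦⟧-≈-by-norm (⊝ (E.q0 ⊗ E.q0 ⊗ E.Rr)) (E.R0 ⊗ E.R0) ≡.refl (c0 ∷ c1 ∷ c2 ∷ a1 ∷ a2 ∷ [])
  where
  open Normalisation R using (⟦⟧-≈-by-norm)
  open Expr using (Ι; _⊗_; ⊝_)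
  module E = GeneralSetting (ExpressionRing.exprRing R 5) (Ι (# 0)) (Ι (# 1)) (Ι (# 2)) (Ι (# 3)) (Ι (# 4))

lemma7 : (c0 c1 c2 : ℤ) → ℤ[X]-Irreducible (cubic c0 c1 c2) →
    ∀ {c ℓ} (R : CommutativeRing c ℓ) (a1 a2 : CommutativeRing.Carrier R) →
      let open CommutativeRing R
          open Setting R c0 c1 c2 a1 a2
      in - (q0 * q0 * Rr) ≈ R0 * R0
lemma7 c0 c1 c2 _ R a1 a2 = resultant-identity R (fromℤ R c0) (fromℤ R c1) (fromℤ R c2) a1 a2
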